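{- Let $k,n$ be positive integers, $G\subseteq S_k$ a subgroup and $\chi:G\to\mathbb{C}\setminus\{0\}$ a one-dimensional character. The relation $\preccurlyeq$ on $B_\chi(k,n)$, defined by $x\preccurlyeq y$ if and only if $x\leqslant g(y)$ componentwise for some $g\in G$, is a partial order.
   Context: $S_k$ acts on $[n]^k$ by $w(x)=(x_{w^{ -1}(1)},\dots,x_{w^{ -1}(k)})$. For $x\in[n]^k$, $O_x=\{g(x):g\in G\}$, $G_x=\{g\in G:g(x)=x\}$, and $\overline{x}$ is the lexicographic minimum of $O_x$. $B_\chi(k,n)=\{\overline{x}:x\in[n]^k,\ G_x\subseteq\ker\chi\}$. The order $\leqslant$ on $[n]^k$ is componentwise. -}

module Defs where

open import Level using (Level; _⊔_) renaming (suc to lsuc; zero to lzero)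
open import Data.Nat using (ℕ)
open import Data.Fin using (Fin; _<_; _≤_)
open import Data.Fin.Permutation using (Permutation′; _⟨$⟩ʳ_; _⟨$⟩ˡ_; _∘ₚ_; id; flip)
import Data.Fin.Permutation as P
open import Data.Vec using (Vec; lookup; tabulate)
open import Data.Product using (Σ; ∃; _×_; _,_; proj₁)
open import Relation.Binary.PropositionalEquality using (_≡_)
open import Algebra.Bundles using (AbelianGroup)

-- The symmetric group S_k : permutations of Fin k, with pointwise equality P._≈_.

record Subgroup (k : ℕ) : Set₁ where
  field
    mem     : Permutation′ k → Set
    mem-resp : ∀ {g h} → g P.≈ h → mem g → mem h
    mem-id  : mem id
    mem-∘   : ∀ {g h} → mem g → mem h → mem (g ∘ₚ h)
    mem-inv : ∀ {g} → mem g → mem (flip g)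

-- A one-dimensional character χ : G → A (A abelian group; for the paper A = ℂ^×),
-- i.e. a group homomorphism from G.
record Character {k : ℕ} (G : Subgroup k) {c ℓ : Level} (A : AbelianGroup c ℓ)
       : Set (c ⊔ ℓ) where
  open Subgroup G
  open AbelianGroup A using (Carrier; _≈_; _∙_)
  field
    χ       : (g : Permutation′ k) → mem g → Carrier
    χ-resp  : ∀ {g h} (p : mem g) (q : mem h) → g P.≈ h → χ g p ≈ χ h q
    χ-hom   : ∀ {g h} (p : mem g) (q : mem h) →
              χ (g ∘ₚ h) (mem-∘ p q) ≈ (χ g p ∙ χ h q)

inKer : ∀ {k c ℓ} {G : Subgroup k} {A : AbelianGroup c ℓ} →
        Character G A → (g : Permutation′ k) → Subgroup.mem G g → Set ℓ
inKer {A = A} ch g p = AbelianGroup._≈_ A (Character.χ ch g p) (AbelianGroup.ε A)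

-- [n]^k, with [n] represented by Fin n (order-isomorphic to {1,…,n}).
Word : ℕ → ℕ → Set
Word k n = Vec (Fin n) k

-- Action: w(x) = (x_{w⁻¹(1)}, …, x_{w⁻¹(k)}).
act : ∀ {k n} → Permutation′ k → Word k n → Word k n
act w x = tabulate (λ i → lookup x (w ⟨$⟩ˡ i))

InOrbit : ∀ {k n} → Subgroup k → Word k n → Word k n → Set
InOrbit G x y = Σ (Permutation′ _) λ g → Subgroup.mem G g × act g x ≡ y

StabInKer : ∀ {k n c ℓ} {G : Subgroup k} {A : AbelianGroup c ℓ} →
            Character G A → Word k n → Set ℓ
StabInKer {G = G} ch x =
  ∀ g (p : Subgroup.mem G g) → act g x ≡ x → inKer ch g p

_<lex_ : ∀ {k n} → Word k n → Word k n → Set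
_<lex_ {k} x y = Σ (Fin k) λ i →
  (∀ j → j < i → lookup x j ≡ lookup y j) × (lookup x i < lookup y i)

_≤lex_ : ∀ {k n} → Word k n → Word k n → Set
x ≤lex y = (x <lex y) Data.Sum.⊎ (x ≡ y)
  where import Data.Sum

IsLexMinOfOrbit : ∀ {k n} → Subgroup k → Word k n → Word k n → Set
IsLexMinOfOrbit G x y = InOrbit G x y × (∀ z → InOrbit G x z → y ≤lex z)

InB : ∀ {k n c ℓ} {G : Subgroup k} {A : AbelianGroup c ℓ} →
      Character G A → Word k n → Set ℓ
InB {k} {n} {G = G} ch y =
  Σ (Word k n) λ x → StabInKer ch x × IsLexMinOfOrbit G x y

B : ∀ {c ℓ} {k : ℕ} (n : ℕ) {G : Subgroup k} {A : AbelianGroup c ℓ} →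
    Character G A → Set ℓ
B {k = k} n ch = Σ (Word k n) (InB ch)

_≤cw_ : ∀ {k n} → Word k n → Word k n → Set
_≤cw_ {k} x y = ∀ i → lookup x i ≤ lookup y i

≼ : ∀ {c ℓ k} (n : ℕ) {G : Subgroup k} {A : AbelianGroup c ℓ} (ch : Character G A) →
    B n ch → B n ch → Set
≼ {k = k} n {G} ch x y =
  Σ (Permutation′ k) λ g → Subgroup.mem G g × (proj₁ x ≤cw act g (proj₁ y))

-- If x ≼ y ≼ x then x ≤ g(y) ≤ σ(x) componentwise for σ = h ∘ g ∈ G. A word dominated
-- componentwise by a permutation of itself equals it (compare the sums of the entries),
-- so x = g(y): x and y lie in one G-orbit, and as both are lexicographic orbit minima
-- they coincide.
module Submission where

open import Defs
open import Level using (Level)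
open import Data.Nat using (ℕ; _≥_)
open import Data.Product using (proj₁)
open import Function using (_on_)
open import Relation.Binary.PropositionalEquality using (_≡_)
open import Relation.Binary.Structures using (IsPartialOrder)
open import Algebra.Bundles using (AbelianGroup)

open import Data.Nat as ℕ using (suc)
import Data.Nat.Properties as ℕ
open import Data.Fin as Fin using (Fin; toℕ)
import Data.Fin.Properties as Fin
open import Data.Fin.Permutation as Perm using (Permutation′; _⟨$⟩ˡ_; _∘ₚ_; flip)
open import Data.Vec using (lookup)
open import Data.Vec.Properties using (lookup∘tabulate; tabulate∘lookup; tabulate-cong)
open import Data.Vec.Functional using (Vector; removeAt; tail)
open import Data.Product using (_,_)
open import Data.Sum using (inj₁; inj₂)
open import Data.Empty using (⊥-elim)
open import Relation.Binary.Definitions using (tri<; tri≈; tri>)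
open import Relation.Binary.PropositionalEquality
  using (refl; sym; trans; cong; subst; subst₂; isEquivalence; module ≡-Reasoning)
import Relation.Binary.Construct.On as On
open import Algebra.Properties.CommutativeMonoid.Sum ℕ.+-0-commutativeMonoid
  using (sum; sum-remove; sum-permute)

private
  variable
    k n : ℕ

sum-mono-≤ : (f g : Vector ℕ k) → (∀ i → f i ℕ.≤ g i) → sum f ℕ.≤ sum g
sum-mono-≤ {ℕ.zero} f g f≤g = ℕ.z≤n
sum-mono-≤ {suc k}  f g f≤g =
  ℕ.+-mono-≤ (f≤g Fin.zero) (sum-mono-≤ (tail f) (tail g) (λ i → f≤g (Fin.suc i)))

pointwise-≤∧sum-≡⇒≡ : (f g : Vector ℕ k) → (∀ i → f i ℕ.≤ g i) → sum f ≡ sum g →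
                      ∀ i → f i ≡ g i
pointwise-≤∧sum-≡⇒≡ {suc k} f g f≤g Σf≡Σg i with ℕ.m≤n⇒m<n∨m≡n (f≤g i)
... | inj₂ fi≡gi = fi≡gi
... | inj₁ fi<gi = ⊥-elim (ℕ.<-irrefl Σf≡Σg Σf<Σg)
  where
  open ℕ.≤-Reasoning
  Σf<Σg : sum f ℕ.< sum g
  Σf<Σg = begin-strict
    sum f                              ≡⟨ sum-remove f ⟩
    f i ℕ.+ sum (removeAt f i)         <⟨ ℕ.+-mono-<-≤ fi<gi
                                            (sum-mono-≤ _ _ (λ j → f≤g (Fin.punchIn i j))) ⟩
    g i ℕ.+ sum (removeAt g i)         ≡⟨ sum-remove g ⟨
    sum g                              ∎

≤-permute⇒≡ : (f : Vector ℕ k) (σ : Permutation′ k) →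
              (∀ i → f i ℕ.≤ f (σ ⟨$⟩ˡ i)) → ∀ i → f i ≡ f (σ ⟨$⟩ˡ i)
≤-permute⇒≡ f σ f≤fσ = pointwise-≤∧sum-≡⇒≡ f _ f≤fσ (sum-permute f (flip σ))

lookup-act : (g : Permutation′ k) (x : Word k n) (i : Fin k) →
             lookup (act g x) i ≡ lookup x (g ⟨$⟩ˡ i)
lookup-act g x i = lookup∘tabulate _ i

≡-ext : {x y : Word k n} → (∀ i → lookup x i ≡ lookup y i) → x ≡ y
≡-ext {x = x} {y} x≗y =
  trans (sym (tabulate∘lookup x)) (trans (tabulate-cong x≗y) (tabulate∘lookup y))

act-id : (x : Word k n) → act Perm.id x ≡ x
act-id x = ≡-ext (lookup-act Perm.id x)

act-∘ : (g h : Permutation′ k) (x : Word k n) → act (g ∘ₚ h) x ≡ act h (act g x)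
act-∘ g h x = ≡-ext λ i → begin
  lookup (act (g ∘ₚ h) x) i           ≡⟨ lookup-act (g ∘ₚ h) x i ⟩
  lookup x (g ⟨$⟩ˡ (h ⟨$⟩ˡ i))        ≡⟨ lookup-act g x _ ⟨
  lookup (act g x) (h ⟨$⟩ˡ i)         ≡⟨ lookup-act h (act g x) i ⟨
  lookup (act h (act g x)) i          ∎
  where open ≡-Reasoning

act-flip : (g : Permutation′ k) (x : Word k n) → act (flip g) (act g x) ≡ x
act-flip g x = ≡-ext λ i → begin
  lookup (act (flip g) (act g x)) i   ≡⟨ lookup-act (flip g) (act g x) i ⟩
  lookup (act g x) (flip g ⟨$⟩ˡ i)    ≡⟨ lookup-act g x _ ⟩
  lookup x (g ⟨$⟩ˡ (flip g ⟨$⟩ˡ i))   ≡⟨ cong (lookup x) (Perm.inverseˡ g) ⟩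
  lookup x i                          ∎
  where open ≡-Reasoning

≤cw-reflexive : {x y : Word k n} → x ≡ y → x ≤cw y
≤cw-reflexive refl i = Fin.≤-refl

≤cw-trans : {x y z : Word k n} → x ≤cw y → y ≤cw z → x ≤cw z
≤cw-trans x≤y y≤z i = Fin.≤-trans (x≤y i) (y≤z i)

≤cw-antisym : {x y : Word k n} → x ≤cw y → y ≤cw x → x ≡ y
≤cw-antisym x≤y y≤x = ≡-ext λ i → Fin.≤-antisym (x≤y i) (y≤x i)

act-mono-∘ : (g h : Permutation′ k) (y z : Word k n) →
             y ≤cw act h z → act g y ≤cw act (h ∘ₚ g) z
act-mono-∘ g h y z y≤hz i =
  subst₂ Fin._≤_ (sym (lookup-act g y i)) (sym (lookup-act (h ∘ₚ g) z i))
    (subst (lookup y (g ⟨$⟩ˡ i) Fin.≤_) (lookup-act h z _) (y≤hz (g ⟨$⟩ˡ i)))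

≤cw-act⇒≡ : (σ : Permutation′ k) {x : Word k n} → x ≤cw act σ x → x ≡ act σ x
≤cw-act⇒≡ σ {x} x≤σx = ≡-ext λ i →
  trans (Fin.toℕ-injective (≤-permute⇒≡ (λ j → toℕ (lookup x j)) σ x≤xσ i))
        (sym (lookup-act σ x i))
  where
  x≤xσ : ∀ i → toℕ (lookup x i) ℕ.≤ toℕ (lookup x (σ ⟨$⟩ˡ i))
  x≤xσ i = subst (λ w → lookup x i Fin.≤ w) (lookup-act σ x i) (x≤σx i)

≤lex-antisym : {x y : Word k n} → x ≤lex y → y ≤lex x → x ≡ y
≤lex-antisym (inj₂ x≡y) _ = x≡y
≤lex-antisym (inj₁ _) (inj₂ y≡x) = sym y≡x
≤lex-antisym (inj₁ (i , x≡y<i , xi<yi)) (inj₁ (j , y≡x<j , yj<xj)) with Fin.<-cmp i j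
... | tri< i<j _ _ = ⊥-elim (Fin.<-irrefl (sym (y≡x<j i i<j)) xi<yi)
... | tri≈ _ refl _ = ⊥-elim (Fin.<-asym xi<yi yj<xj)
... | tri> _ _ j<i = ⊥-elim (Fin.<-irrefl (sym (x≡y<i j j<i)) yj<xj)

module _ (G : Subgroup k) where
  open Subgroup G

  InOrbit-act : {x y : Word k n} (g : Permutation′ k) → mem g →
                InOrbit G x y → InOrbit G x (act g y)
  InOrbit-act {x = x} g g∈G (a , a∈G , ax≡y) =
    a ∘ₚ g , mem-∘ a∈G g∈G , trans (act-∘ a g x) (cong (act g) ax≡y)

  lexMin-unique : {x₀ y₀ x y : Word k n} (g : Permutation′ k) → mem g →
                  IsLexMinOfOrbit G x₀ x → IsLexMinOfOrbit G y₀ y → x ≡ act g y → x ≡ y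
  lexMin-unique {x₀ = x₀} {y₀} {x} {y} g g∈G (x∈Ox₀ , x-min) (y∈Oy₀ , y-min) x≡gy =
    ≤lex-antisym (x-min y y∈Ox₀) (y-min x x∈Oy₀)
    where
    y≡g⁻¹x : act (flip g) x ≡ y
    y≡g⁻¹x = trans (cong (act (flip g)) x≡gy) (act-flip g y)
    y∈Ox₀ : InOrbit G x₀ y
    y∈Ox₀ = subst (InOrbit G x₀) y≡g⁻¹x (InOrbit-act {x = x₀} (flip g) (mem-inv g∈G) x∈Ox₀)
    x∈Oy₀ : InOrbit G y₀ x
    x∈Oy₀ = subst (InOrbit G y₀) (sym x≡gy) (InOrbit-act {x = y₀} g g∈G y∈Oy₀)

module _ {c ℓ : Level} {G : Subgroup k} {A : AbelianGroup c ℓ} (ch : Character G A) where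
  open Subgroup G

  ≼-reflexive : {x y : B n ch} → proj₁ x ≡ proj₁ y → ≼ n ch x y
  ≼-reflexive {x = x , _} {y , _} x≡y =
    Perm.id , mem-id , ≤cw-reflexive {x = x} (trans x≡y (sym (act-id y)))

  ≼-trans : {x y z : B n ch} → ≼ n ch x y → ≼ n ch y z → ≼ n ch x z
  ≼-trans {x = x , _} {y , _} {z , _} (g , g∈G , x≤gy) (h , h∈G , y≤hz) =
    h ∘ₚ g , mem-∘ h∈G g∈G ,
    ≤cw-trans {x = x} {act g y} {act (h ∘ₚ g) z} x≤gy (act-mono-∘ g h y z y≤hz)

  ≼-antisym : {x y : B n ch} → ≼ n ch x y → ≼ n ch y x → proj₁ x ≡ proj₁ y
  ≼-antisym {x = x , x₀ , _ , x-min} {y , y₀ , _ , y-min} (g , g∈G , x≤gy) (h , h∈G , y≤hx) =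
    lexMin-unique G {x₀ = x₀} {y₀} g g∈G x-min y-min x≡gy
    where
    gy≤σx : act g y ≤cw act (h ∘ₚ g) x
    gy≤σx = act-mono-∘ g h y x y≤hx
    x≡σx : x ≡ act (h ∘ₚ g) x
    x≡σx = ≤cw-act⇒≡ (h ∘ₚ g) {x} (≤cw-trans {x = x} {act g y} {act (h ∘ₚ g) x} x≤gy gy≤σx)
    x≡gy : x ≡ act g y
    x≡gy = ≤cw-antisym {x = x} {act g y} x≤gy (subst (act g y ≤cw_) (sym x≡σx) gy≤σx)

proposition4p2 : ∀ {c ℓ : Level} (k n : ℕ) → k ≥ 1 → n ≥ 1 →
    (G : Subgroup k) (A : AbelianGroup c ℓ) (ch : Character G A) →
    IsPartialOrder (_≡_ on proj₁) (≼ n ch)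
proposition4p2 k n _ _ G A ch = record
  { isPreorder = record
    { isEquivalence = On.isEquivalence proj₁ isEquivalence
    ; reflexive     = λ {x} {y} → ≼-reflexive ch {x = x} {y}
    ; trans         = λ {x} {y} {z} → ≼-trans ch {x = x} {y} {z}
    }
  ; antisym = λ {x} {y} → ≼-antisym ch {x = x} {y}
  }
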